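{- For each edit type $\mathrm{edit} \in \{\mathrm{sub}, \mathrm{ins}, \mathrm{del}\}$, $\mathrm{AS}_{\mathrm{edit}}(\gamma, n) = O(\sqrt{n})$.
   Context: Strings are finite sequences over an alphabet $\Sigma$; $T[i]$ is the $i$-th character and $T[i..j]$ the substring from position $i$ to $j$. A set $\Gamma$ of positions of a nonempty string $T$ of length $n$ is a string attractor of $T$ if every substring $s$ of $T$ has an occurrence $T[i..j]=s$ with $i \le p \le j$ for some $p \in \Gamma$. $\gamma(T)$ denotes the minimum size of a string attractor of $T$. For a measure $c$ on strings, the worst-case additive sensitivity is $\mathrm{AS}_{\mathrm{edit}}(c,n) = \max\{ c(T') - c(T) \}$, where the maximum ranges over all strings $T$ of length $n$ and all strings $T'$ obtainable from $T$ by a single edit operation of type $\mathrm{edit}$: substitution of one character ($|T'|=n$), insertion of one character ($|T'|=n+1$), or deletion of one character ($|T'|=n-1$). -}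

module Defs where

open import Data.Nat using (ℕ; suc; _≤_; _<_; _∸_)
open import Data.List using (List; _∷_; _++_; take; drop; length)
open import Data.Fin using (Fin; toℕ)
open import Data.Fin.Subset using (Subset; _∈_; ∣_∣)
open import Data.Product using (Σ; ∃; _×_; _,_)
open import Relation.Binary.PropositionalEquality using (_≡_)

-- Positions are 0-based. slice T i j = T[i..j] (inclusive).
slice : {A : Set} → List A → ℕ → ℕ → List A
slice T i j = take (suc j ∸ i) (drop i T)

IsAttractor : {A : Set} (T : List A) → Subset (length T) → Set
IsAttractor T Γ =
  ∀ i j → i ≤ j → j < length T →
  Σ ℕ λ i' → Σ ℕ λ j' →
    i' ≤ j' × j' < length T × slice T i' j' ≡ slice T i j ×
    (Σ (Fin (length T)) λ p → p ∈ Γ × i' ≤ toℕ p × toℕ p ≤ j')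

IsGamma : {A : Set} → List A → ℕ → Set
IsGamma T g =
  (Σ (Subset (length T)) λ Γ → IsAttractor T Γ × ∣ Γ ∣ ≡ g) ×
  (∀ (Γ : Subset (length T)) → IsAttractor T Γ → g ≤ ∣ Γ ∣)

data EditType : Set where
  sub ins del : EditType

OneEdit : {A : Set} → EditType → List A → List A → Set
OneEdit {A} sub T T' = Σ ℕ λ i → Σ A λ c → i < length T × T' ≡ take i T ++ (c ∷ drop (suc i) T)
OneEdit {A} ins T T' = Σ ℕ λ i → Σ A λ c → i ≤ length T × T' ≡ take i T ++ (c ∷ drop i T)
OneEdit {A} del T T' = Σ ℕ λ i → i < length T × T' ≡ take i T ++ drop (suc i) T

-- Write T = X ++ u ++ Y and T' = X ++ v ++ Y with |u|, |v| ≤ 1, let x = |X|, and choose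
-- K = k + 1 with k² ≤ |T| < K².  From an attractor Γ of T we build one of T' with at most
-- |Γ| + 2K + 1 positions: Γ shifted across the edit, the position x, one position in each
-- block of K consecutive positions (hitting every window of length ≥ K), and for each d < K a
-- position q_d at which T' contains every prefix of length < K of T[x − d ..] that occurs in
-- T' at all (an occurrence of the longest such prefix).  A short window of T' not containing x
-- is also a window of T, so it has an occurrence in T containing a point of Γ.  If that
-- occurrence avoids the edit it is shifted to T'; otherwise it starts at some x − d with d < K,
-- and then it occurs in T' at q_d.  Hence γ(T') − γ(T) ≤ 2K + 1 ≤ 5√|T|.  The positions q_d
-- exist only classically, which is harmless because the inequality to prove is decidable.

module Submission where

open import Defs
open import Data.Fin using (Fin; toℕ; fromℕ<) renaming (zero to fzero; suc to fsuc)
open import Data.Fin.Properties using (toℕ-fromℕ<)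
open import Data.Fin.Subset using (Subset; ∣_∣; ⁅_⁆; _∪_; ⊥; inside; outside) renaming (_∈_ to _∈ₛ_)
open import Data.Fin.Subset.Properties using (x∈⁅x⁆; ∣⁅x⁆∣≡1; ∣⊥∣≡0; p⊆p∪q; q⊆p∪q)
open import Data.List using (List; []; _∷_; _++_; take; drop; length; map; applyUpTo)
open import Data.List.Membership.Propositional using (_∈_; find; lose)
open import Data.List.Membership.Propositional.Properties using (∈-map⁺; ∈-applyUpTo⁺)
open import Data.List.Properties
  using (length-take; length-drop; take-take; length-++; length-map; length-applyUpTo; take++drop≡id)
open import Data.List.Relation.Unary.Any as Any using (Any; here; there)
open import Data.List.Relation.Unary.Any.Properties using (map⁺; ++⁺ˡ; ++⁺ʳ)
open import Data.Nat
open import Data.Nat.DivMod using (_/_; _%_; m≡m%n+[m/n]*n; m%n<n; m<n*o⇒m/o<n)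
open import Data.Nat.Properties
open import Data.Nat.Tactic.RingSolver using (solve-∀)
open import Data.Product using (Σ; ∃; _×_; _,_; map₂)
open import Data.Sum using ([_,_]′)
open import Data.Vec.Base using (_∷_; []; _[_]=_)
open import Effect.Monad using (RawMonad)
open import Level using (0ℓ)
open import Relation.Binary.PropositionalEquality
open import Relation.Nullary using (yes; no; contradiction)
open import Relation.Nullary.Decidable using (¬¬-excluded-middle; decidable-stable)
open import Relation.Nullary.Negation using (DoubleNegation; ¬¬-Monad)

open _[_]=_ renaming (here to hereₛ; there to thereₛ)

private variable
  A : Set

window : List A → ℕ → ℕ → List A
window W i l = take l (drop i W)

length-window : (W : List A) {i l : ℕ} → i + l ≤ length W → length (window W i l) ≡ l
length-window W {i} {l} fits = begin
  length (take l (drop i W))  ≡⟨ length-take l (drop i W) ⟩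
  l ⊓ length (drop i W)       ≡⟨ m≤n⇒m⊓n≡m l≤rest ⟩
  l                           ∎
  where
  open ≡-Reasoning
  l≤rest : l ≤ length (drop i W)
  l≤rest = subst (l ≤_) (sym (length-drop i W))
    (subst (_≤ length W ∸ i) (m+n∸m≡n i l) (∸-monoˡ-≤ i fits))

take-window : (W : List A) {i l L : ℕ} → l ≤ L → take l (window W i L) ≡ window W i l
take-window W {i} {l} {L} l≤L =
  trans (take-take l L (drop i W)) (cong (λ n → take n (drop i W)) (m≤n⇒m⊓n≡m l≤L))

window-++ˡ : (P Q : List A) {i l : ℕ} → i + l ≤ length P → window (P ++ Q) i l ≡ window P i l
window-++ˡ []      Q {zero}  {zero}  _         = refl
window-++ˡ (a ∷ P) Q {zero}  {zero}  _         = refl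
window-++ˡ (a ∷ P) Q {zero}  {suc l} (s≤s fits) = cong (a ∷_) (window-++ˡ P Q fits)
window-++ˡ (a ∷ P) Q {suc i} {l}     (s≤s fits) = window-++ˡ P Q fits

window-++ʳ : (P Q : List A) (j l : ℕ) → window (P ++ Q) (length P + j) l ≡ window Q j l
window-++ʳ []      Q j l = refl
window-++ʳ (a ∷ P) Q j l = window-++ʳ P Q j l

slice-window : (W : List A) (i l : ℕ) → slice W i (i + l) ≡ window W i (suc l)
slice-window W i l =
  cong (λ n → take n (drop i W)) (trans (cong (_∸ i) (sym (+-suc i l))) (m+n∸m≡n i (suc l)))

InWindow : ℕ → ℕ → ℕ → Set
InWindow i l p = ∃ λ r → r < l × i + r ≡ p

OccursAt : List A → ℕ → List A → ℕ → Set
OccursAt W l s q = q + l ≤ length W × window W q l ≡ s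

MarkedOccurrence : List A → List ℕ → ℕ → List A → Set
MarkedOccurrence W P l s = Σ ℕ λ q → OccursAt W l s q × Any (InWindow q l) P

occursAt-prefix : (W V : List A) (a : ℕ) {l L q : ℕ} → l ≤ L →
                  OccursAt W L (window V a L) q → OccursAt W l (window V a l) q
occursAt-prefix W V a {l} {L} {q} l≤L (q+L≤n , same) =
  ≤-trans (+-monoʳ-≤ q l≤L) q+L≤n ,
  trans (sym (take-window W {q} l≤L)) (trans (cong (take l) same) (take-window V {a} l≤L))

Covers : List A → List ℕ → Set
Covers W P = ∀ i l → 0 < l → i + l ≤ length W → MarkedOccurrence W P l (window W i l)

positions : ∀ {n} → Subset n → List ℕ
positions []            = []
positions (inside  ∷ Γ) = 0 ∷ map suc (positions Γ)
positions (outside ∷ Γ) = map suc (positions Γ)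

length-positions : ∀ {n} (Γ : Subset n) → length (positions Γ) ≡ ∣ Γ ∣
length-positions []            = refl
length-positions (inside  ∷ Γ) = cong suc (trans (length-map suc (positions Γ)) (length-positions Γ))
length-positions (outside ∷ Γ) = trans (length-map suc (positions Γ)) (length-positions Γ)

∈-positions : ∀ {n} {Γ : Subset n} {p : Fin n} → p ∈ₛ Γ → toℕ p ∈ positions Γ
∈-positions {Γ = inside  ∷ Γ} {fzero}  hereₛ        = here refl
∈-positions {Γ = inside  ∷ Γ} {fsuc p} (thereₛ p∈Γ) = there (∈-map⁺ suc (∈-positions p∈Γ))
∈-positions {Γ = outside ∷ Γ} {fsuc p} (thereₛ p∈Γ) = ∈-map⁺ suc (∈-positions p∈Γ)

∣p∪q∣≤∣p∣+∣q∣ : ∀ {n} (p q : Subset n) → ∣ p ∪ q ∣ ≤ ∣ p ∣ + ∣ q ∣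
∣p∪q∣≤∣p∣+∣q∣ []            []            = z≤n
∣p∪q∣≤∣p∣+∣q∣ (outside ∷ p) (outside ∷ q) = ∣p∪q∣≤∣p∣+∣q∣ p q
∣p∪q∣≤∣p∣+∣q∣ (outside ∷ p) (inside  ∷ q) =
  subst (suc ∣ p ∪ q ∣ ≤_) (sym (+-suc ∣ p ∣ ∣ q ∣)) (s≤s (∣p∪q∣≤∣p∣+∣q∣ p q))
∣p∪q∣≤∣p∣+∣q∣ (inside  ∷ p) (outside ∷ q) = s≤s (∣p∪q∣≤∣p∣+∣q∣ p q)
∣p∪q∣≤∣p∣+∣q∣ (inside  ∷ p) (inside  ∷ q) =
  s≤s (≤-trans (m≤n⇒m≤1+n (∣p∪q∣≤∣p∣+∣q∣ p q)) (≤-reflexive (sym (+-suc ∣ p ∣ ∣ q ∣))))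

fromPositions : (n : ℕ) → List ℕ → Subset n
fromPositions n []      = ⊥
fromPositions n (p ∷ P) with p <? n
... | yes p<n = ⁅ fromℕ< p<n ⁆ ∪ fromPositions n P
... | no  _   = fromPositions n P

∣fromPositions∣≤length : (n : ℕ) (P : List ℕ) → ∣ fromPositions n P ∣ ≤ length P
∣fromPositions∣≤length n []      = ≤-reflexive (∣⊥∣≡0 n)
∣fromPositions∣≤length n (p ∷ P) with p <? n
... | yes p<n = ≤-trans (∣p∪q∣≤∣p∣+∣q∣ ⁅ fromℕ< p<n ⁆ (fromPositions n P))
  (subst (λ c → c + ∣ fromPositions n P ∣ ≤ suc (length P)) (sym (∣⁅x⁆∣≡1 (fromℕ< p<n)))
    (s≤s (∣fromPositions∣≤length n P)))
... | no  _   = m≤n⇒m≤1+n (∣fromPositions∣≤length n P)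

∈-fromPositions : ∀ {n P p} → p ∈ P → (p<n : p < n) → fromℕ< p<n ∈ₛ fromPositions n P
∈-fromPositions {n} {p ∷ P} (here refl) p<n with p <? n
... | yes _   = p⊆p∪q (fromPositions n P) (x∈⁅x⁆ (fromℕ< p<n))
... | no  p≮n = contradiction p<n p≮n
∈-fromPositions {n} {q ∷ P} (there p∈P) p<n with q <? n
... | yes q<n = q⊆p∪q ⁅ fromℕ< q<n ⁆ (fromPositions n P) (∈-fromPositions p∈P p<n)
... | no  _   = ∈-fromPositions p∈P p<n

window-≡⇒length-≡ : (W : List A) {i l i' l' : ℕ} → i' + l' ≤ length W → i + l ≤ length W →
                    window W i' l' ≡ window W i l → l' ≡ l
window-≡⇒length-≡ W fits' fits same =
  trans (sym (length-window W fits')) (trans (cong length same) (length-window W fits))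

attractor⇒covers : {W : List A} {Γ : Subset (length W)} → IsAttractor W Γ → Covers W (positions Γ)
attractor⇒covers {W = W} att i (suc l) _ i+l<n
  with i' , j' , i'≤j' , j'<n , same , p , p∈Γ , i'≤p , p≤j'
         ← att i (i + l) (m≤m+n i l) (subst (_≤ length W) (+-suc i l) i+l<n)
  with l' , refl ← m≤n⇒∃[o]m+o≡n i'≤j'
  with r , i'+r≡p ← m≤n⇒∃[o]m+o≡n i'≤p
  with same′ ← trans (sym (slice-window W i' l')) (trans same (slice-window W i l))
  with i'+l'<n ← subst (_≤ length W) (sym (+-suc i' l')) j'<n
  with refl ← suc-injective (window-≡⇒length-≡ W i'+l'<n i+l<n same′)
  = i' , (i'+l'<n , same′) ,
    lose (∈-positions p∈Γ)
         (r , s≤s (+-cancelˡ-≤ i' r l (subst (_≤ i' + l) (sym i'+r≡p) p≤j')) , i'+r≡p)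

covers⇒attractor : {W : List A} {P : List ℕ} → Covers W P → IsAttractor W (fromPositions (length W) P)
covers⇒attractor {W = W} cov i j i≤j j<n
  with l , refl ← m≤n⇒∃[o]m+o≡n i≤j
  with q , (q+l<n , same) , hit ← cov i (suc l) (s≤s z≤n) (subst (_≤ length W) (sym (+-suc i l)) j<n)
  with _ , p∈P , r , r<l , refl ← find hit
  with p<n ← <-≤-trans (+-monoʳ-< q r<l) q+l<n
  = q , q + l , m≤m+n q l , subst (_≤ length W) (+-suc q l) q+l<n ,
    trans (slice-window W q l) (trans same (sym (slice-window W i l))) ,
    fromℕ< p<n , ∈-fromPositions p∈P p<n ,
    subst (q ≤_) (sym (toℕ-fromℕ< p<n)) (m≤m+n q r) ,
    subst (_≤ q + l) (sym (toℕ-fromℕ< p<n)) (+-monoʳ-≤ q (s≤s⁻¹ r<l))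

γ-covering : {W : List A} {g : ℕ} → IsGamma W g → Σ (List ℕ) λ P → Covers W P × length P ≡ g
γ-covering ((Γ , att , refl) , _) = positions Γ , attractor⇒covers att , length-positions Γ

γ≤length : {W : List A} {g : ℕ} {P : List ℕ} → IsGamma W g → Covers W P → g ≤ length P
γ≤length {W = W} {P = P} (_ , minimal) cov =
  ≤-trans (minimal _ (covers⇒attractor cov)) (∣fromPositions∣≤length (length W) P)

open RawMonad (¬¬-Monad {a = 0ℓ}) using (pure; _>>=_)

module _ {P : ℕ → ℕ → Set} where

  -- A witness for the largest l < L with P l inhabited serves every smaller l as well.
  ¬¬-commonWitness : (∀ {l L q} → l ≤ L → P L q → P l q) →
                     ∀ L → DoubleNegation (Σ ℕ λ q → ∀ l → l < L → ∃ (P l) → P l q)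
  ¬¬-commonWitness down zero    = pure (0 , λ _ ())
  ¬¬-commonWitness down (suc L) = do
    q , common ← ¬¬-commonWitness down L
    yes (q' , PLq') ← ¬¬-excluded-middle {A = ∃ (P L)}
      where no ∄PL → pure (q , λ l l<1+L found →
              [ (λ l<L → common l l<L found) , (λ { refl → contradiction found ∄PL }) ]′
                (m<1+n⇒m<n∨m≡n l<1+L))
    pure (q' , λ l l<1+L _ → down (s≤s⁻¹ l<1+L) PLq')

  ¬¬-choice : (∀ d → DoubleNegation (∃ (P d))) →
              ∀ n → DoubleNegation (Σ (List ℕ) λ qs → length qs ≡ n × (∀ d → d < n → Any (P d) qs))
  ¬¬-choice choose zero    = pure ([] , refl , λ _ ())
  ¬¬-choice choose (suc n) = do
    qs , length≡n , hits ← ¬¬-choice choose n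
    q , Pnq ← choose n
    pure (q ∷ qs , cong suc length≡n , λ d d<1+n →
      [ (λ d<n → there (hits d d<n)) , (λ { refl → here Pnq }) ]′ (m<1+n⇒m<n∨m≡n d<1+n))

data Region (x m l : ℕ) : ℕ → Set where
  before : ∀ {i} → i + l ≤ x → Region x m l i
  after  : ∀ j → Region x m l (x + m + j)
  across : ∀ {i} → InWindow i l x → Region x m l i

region : ∀ {m} x l i → m ≤ 1 → Region x m l i
region {m} x l i m≤1 with i + l ≤? x | x + m ≤? i
... | yes i+l≤x | _         = before i+l≤x
... | no  _     | yes x+m≤i = subst (Region x m l) (m+[n∸m]≡n x+m≤i) (after (i ∸ (x + m)))
... | no  i+l≰x | no  x+m≰i = across (x ∸ i , x∸i<l , m+[n∸m]≡n i≤x)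
  where
  i≤x : i ≤ x
  i≤x = s≤s⁻¹ (≤-trans (≰⇒> x+m≰i) (≤-trans (+-monoʳ-≤ x m≤1) (≤-reflexive (+-comm x 1))))
  x∸i<l : x ∸ i < l
  x∸i<l = subst (x ∸ i <_) (m+n∸m≡n i l) (∸-monoˡ-< (≰⇒> i+l≰x) i≤x)

module _ (X M Y : List A) where

  length-++-++ : length (X ++ M ++ Y) ≡ length X + length M + length Y
  length-++-++ =
    trans (length-++ X) (trans (cong (length X +_) (length-++ M)) (sym (+-assoc (length X) _ _)))

  fits-before : ∀ {i l} → i + l ≤ length X → i + l ≤ length (X ++ M ++ Y)
  fits-before i+l≤x = ≤-trans i+l≤x (subst (length X ≤_) (sym (length-++ X)) (m≤m+n _ _))

  window-before : ∀ {i l} → i + l ≤ length X → window (X ++ M ++ Y) i l ≡ window X i l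
  window-before = window-++ˡ X (M ++ Y)

  window-after : ∀ j l → window (X ++ M ++ Y) (length X + length M + j) l ≡ window Y j l
  window-after j l = begin
    window (X ++ M ++ Y) (length X + length M + j) l
      ≡⟨ cong (λ i → window (X ++ M ++ Y) i l) (+-assoc (length X) _ j) ⟩
    window (X ++ M ++ Y) (length X + (length M + j)) l
      ≡⟨ window-++ʳ X (M ++ Y) (length M + j) l ⟩
    window (M ++ Y) (length M + j) l
      ≡⟨ window-++ʳ M Y j l ⟩
    window Y j l
      ∎
    where open ≡-Reasoning

  fits-after⁺ : ∀ {j l} → j + l ≤ length Y → length X + length M + j + l ≤ length (X ++ M ++ Y)
  fits-after⁺ {j} {l} j+l≤y = subst₂ _≤_ (sym (+-assoc (length X + length M) j l)) (sym length-++-++)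
    (+-monoʳ-≤ (length X + length M) j+l≤y)

  fits-after⁻ : ∀ {j l} → length X + length M + j + l ≤ length (X ++ M ++ Y) → j + l ≤ length Y
  fits-after⁻ {j} {l} fits = +-cancelˡ-≤ (length X + length M) (j + l) (length Y)
    (subst₂ _≤_ (+-assoc (length X + length M) j l) length-++-++ fits)

blocks : ℕ → List ℕ
blocks k = applyUpTo (λ t → t * suc k + k) (suc k)

blocks-hit : ∀ k {i l} → i < suc k * suc k → suc k ≤ l → Any (InWindow i l) (blocks k)
blocks-hit k {i} {l} i<K² K≤l =
  lose (∈-applyUpTo⁺ (λ t → t * K + k) (m<n*o⇒m/o<n i<K²)) (k ∸ i % K , r<l , i+r≡block)
  where
  open ≡-Reasoning
  K = suc k
  r<l : k ∸ i % K < l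
  r<l = <-≤-trans (s≤s (m∸n≤m k (i % K))) K≤l
  i+r≡block : i + (k ∸ i % K) ≡ i / K * K + k
  i+r≡block = begin
    i + (k ∸ i % K)                   ≡⟨ cong (_+ (k ∸ i % K)) (m≡m%n+[m/n]*n i K) ⟩
    i % K + i / K * K + (k ∸ i % K)   ≡⟨ cong (_+ (k ∸ i % K)) (+-comm (i % K) _) ⟩
    i / K * K + i % K + (k ∸ i % K)   ≡⟨ +-assoc (i / K * K) _ _ ⟩
    i / K * K + (i % K + (k ∸ i % K)) ≡⟨ cong (i / K * K +_) (m+[n∸m]≡n (s≤s⁻¹ (m%n<n i K))) ⟩
    i / K * K + k                     ∎

module Edit {A : Set} (X Y : List A) {u v : List A} (u≤1 : length u ≤ 1) (v≤1 : length v ≤ 1)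
            (k : ℕ) where

  T T' : List A
  T  = X ++ u ++ Y
  T' = X ++ v ++ Y

  x : ℕ
  x = length X

  shift : ℕ → ℕ
  shift p with p <? x
  ... | yes _ = p
  ... | no  _ = x + length v + (p ∸ (x + length u))

  shift-before : ∀ {p} → p < x → shift p ≡ p
  shift-before {p} p<x with p <? x
  ... | yes _   = refl
  ... | no  p≮x = contradiction p<x p≮x

  shift-after : ∀ j → shift (x + length u + j) ≡ x + length v + j
  shift-after j with x + length u + j <? x
  ... | yes p<x = contradiction p<x (≤⇒≯ (≤-trans (m≤m+n x _) (m≤m+n (x + length u) j)))
  ... | no  _   = cong (x + length v +_) (m+n∸m≡n (x + length u) j)

  inWindow-shift-before : ∀ {q l p} → q + l ≤ x → InWindow q l p → InWindow q l (shift p)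
  inWindow-shift-before {q} q+l≤x (r , r<l , refl) =
    r , r<l , sym (shift-before (<-≤-trans (+-monoʳ-< q r<l) q+l≤x))

  inWindow-shift-after : ∀ {j l p} → InWindow (x + length u + j) l p →
                         InWindow (x + length v + j) l (shift p)
  inWindow-shift-after {j} (r , r<l , refl) = r , r<l , sym (begin
    shift (x + length u + j + r)   ≡⟨ cong shift (+-assoc (x + length u) j r) ⟩
    shift (x + length u + (j + r)) ≡⟨ shift-after (j + r) ⟩
    x + length v + (j + r)         ≡⟨ +-assoc (x + length v) j r ⟨
    x + length v + j + r           ∎)
    where open ≡-Reasoning

  Good : ℕ → ℕ → Set
  Good d q = ∀ l → l < suc k →
             ∃ (OccursAt T' l (window T (x ∸ d) l)) → OccursAt T' l (window T (x ∸ d) l) q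

  ¬¬-good : ∀ d → DoubleNegation (∃ (Good d))
  ¬¬-good d = ¬¬-commonWitness (occursAt-prefix T' T (x ∸ d)) (suc k)

  marks : List ℕ → List ℕ → List ℕ
  marks P qs = map shift P ++ x ∷ blocks k ++ qs

  length-marks : ∀ P qs → length (marks P qs) ≡ length P + suc (suc k + length qs)
  length-marks P qs = begin
    length (map shift P ++ x ∷ blocks k ++ qs)
      ≡⟨ length-++ (map shift P) ⟩
    length (map shift P) + suc (length (blocks k ++ qs))
      ≡⟨ cong₂ (λ a b → a + suc b) (length-map shift P) (length-++ (blocks k)) ⟩
    length P + suc (length (blocks k) + length qs)
      ≡⟨ cong (λ b → length P + suc (b + length qs)) (length-applyUpTo (λ t → t * suc k + k) (suc k)) ⟩
    length P + suc (suc k + length qs)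
      ∎
    where open ≡-Reasoning

  window-before-edit : ∀ {i l} → i + l ≤ x → window T' i l ≡ window T i l
  window-before-edit i+l≤x = trans (window-before X v Y i+l≤x) (sym (window-before X u Y i+l≤x))

  window-after-edit : ∀ j l → window T' (x + length v + j) l ≡ window T (x + length u + j) l
  window-after-edit j l = trans (window-after X v Y j l) (sym (window-after X u Y j l))

  module _ {P qs : List ℕ} (covT : Covers T P) (goods : ∀ d → d < suc k → Any (Good d) qs) where

    via-T : ∀ {a l} → 0 < l → l < suc k → a + l ≤ length T → ∃ (OccursAt T' l (window T a l)) →
            MarkedOccurrence T' (marks P qs) l (window T a l)
    via-T {a} {l} 0<l l<K a+l≤n found with covT a l 0<l a+l≤n
    ... | q , (q+l≤n , same) , hit with region x l q u≤1
    ...   | before q+l≤x =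
      q , (fits-before X v Y {q} q+l≤x , trans (window-before-edit {q} q+l≤x) same) ,
      ++⁺ˡ (map⁺ (Any.map (inWindow-shift-before q+l≤x) hit))
    ...   | after j =
      x + length v + j ,
      (fits-after⁺ X v Y (fits-after⁻ X u Y q+l≤n) , trans (window-after-edit j l) same) ,
      ++⁺ˡ (map⁺ (Any.map inWindow-shift-after hit))
    ...   | across (d , d<l , q+d≡x) with find (goods d (<-trans d<l l<K))
    ...     | q' , q'∈qs , good =
      q' ,
      subst (λ s → OccursAt T' l s q') same′
        (good l l<K (subst (λ s → ∃ (OccursAt T' l s)) (sym same′) found)) ,
      ++⁺ʳ (map shift P) (there (++⁺ʳ (blocks k) (lose q'∈qs (0 , 0<l , +-identityʳ q'))))
      where
      x∸d≡q : x ∸ d ≡ q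
      x∸d≡q = trans (cong (_∸ d) (sym q+d≡x)) (m+n∸n≡m q d)
      same′ : window T (x ∸ d) l ≡ window T a l
      same′ = trans (cong (λ i → window T i l) x∸d≡q) same

    covers-edit : length T' ≤ suc k * suc k → Covers T' (marks P qs)
    covers-edit T'≤K² i l 0<l i+l≤n with suc k ≤? l
    ... | yes K≤l =
      i , (i+l≤n , refl) ,
      ++⁺ʳ (map shift P) (there (++⁺ˡ (blocks-hit k i<K² K≤l)))
      where
      i<K² : i < suc k * suc k
      i<K² = <-≤-trans (<-≤-trans (m<m+n i 0<l) i+l≤n) T'≤K²
    ... | no K≰l with region x l i v≤1
    ...   | across i+d≡x = i , (i+l≤n , refl) , ++⁺ʳ (map shift P) (here i+d≡x)
    ...   | before i+l≤x =
      subst (MarkedOccurrence T' (marks P qs) l) (sym (window-before-edit {i} i+l≤x))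
        (via-T 0<l (≰⇒> K≰l) (fits-before X u Y {i} i+l≤x) (i , i+l≤n , window-before-edit {i} i+l≤x))
    ...   | after j =
      subst (MarkedOccurrence T' (marks P qs) l) (sym (window-after-edit j l))
        (via-T 0<l (≰⇒> K≰l) (fits-after⁺ X u Y (fits-after⁻ X v Y i+l≤n))
               (x + length v + j , i+l≤n , window-after-edit j l))

open Edit using (¬¬-good; covers-edit; length-marks)

γ-replace-≤ : (X Y : List A) {u v : List A} → length u ≤ 1 → length v ≤ 1 → (k : ℕ) →
              length (X ++ v ++ Y) ≤ suc k * suc k → {g g' : ℕ} →
              IsGamma (X ++ u ++ Y) g → IsGamma (X ++ v ++ Y) g' → g' ≤ g + suc (suc k + suc k)
γ-replace-≤ X Y u≤1 v≤1 k T'≤K² {g' = g'} γT γT' with P , covT , refl ← γ-covering γT =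
  decidable-stable (g' ≤? _) do
    qs , |qs|≡K , goods ← ¬¬-choice (¬¬-good X Y u≤1 v≤1 k) (suc k)
    pure (≤-trans (γ≤length γT' (covers-edit X Y u≤1 v≤1 k covT goods T'≤K²))
                  (≤-reflexive (trans (length-marks X Y u≤1 v≤1 k P qs)
                                      (cong (λ m → length P + suc (suc k + m)) |qs|≡K))))

data Replacement {A : Set} : List A → List A → Set where
  replace : (X Y : List A) {u v : List A} → length u ≤ 1 → length v ≤ 1 →
            Replacement (X ++ u ++ Y) (X ++ v ++ Y)

split-at : (T : List A) {i : ℕ} → i < length T → ∃ λ t → take i T ++ t ∷ drop (suc i) T ≡ T
split-at (t ∷ T) {zero}  _         = t , refl
split-at (t ∷ T) {suc i} (s≤s i<n) = map₂ (cong (t ∷_)) (split-at T i<n)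

oneEdit⇒replacement : ∀ e {T T' : List A} → OneEdit e T T' → Replacement T T'
oneEdit⇒replacement sub {T} (i , c , i<n , refl) with t , T≡ ← split-at T i<n =
  subst (λ S → Replacement S (take i T ++ c ∷ drop (suc i) T)) T≡
    (replace (take i T) (drop (suc i) T) {t ∷ []} (s≤s z≤n) (s≤s z≤n))
oneEdit⇒replacement ins {T} (i , c , _ , refl) =
  subst (λ S → Replacement S (take i T ++ c ∷ drop i T)) (take++drop≡id i T)
    (replace (take i T) (drop i T) {[]} z≤n (s≤s z≤n))
oneEdit⇒replacement del {T} (i , i<n , refl) with t , T≡ ← split-at T i<n =
  subst (λ S → Replacement S (take i T ++ drop (suc i) T)) T≡
    (replace (take i T) (drop (suc i) T) {t ∷ []} (s≤s z≤n) z≤n)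

length-replacement≤ : {T T' : List A} → Replacement T T' → length T' ≤ suc (length T)
length-replacement≤ (replace X Y {u} {v} _ v≤1) =
  subst₂ _≤_ (sym (length-++-++ X v Y)) (cong suc (sym (length-++-++ X u Y)))
    (+-monoˡ-≤ (length Y) (≤-trans (+-monoʳ-≤ (length X) v≤1)
      (≤-trans (≤-reflexive (+-comm (length X) 1)) (s≤s (m≤m+n (length X) (length u))))))

isqrt : ∀ n → Σ ℕ λ k → k * k ≤ n × n < suc k * suc k
isqrt zero = 0 , z≤n , s≤s z≤n
isqrt (suc n) with k , k²≤n , n<K² ← isqrt n with suc n <? suc k * suc k
... | yes n+1<K² = k , m≤n⇒m≤1+n k²≤n , n+1<K²
... | no  n+1≮K² =
  suc k , ≤-reflexive K²≡n+1 ,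
  subst (_< suc (suc k) * suc (suc k)) K²≡n+1 (*-mono-< (n<1+n (suc k)) (n<1+n (suc k)))
  where
  K²≡n+1 : suc k * suc k ≡ suc n
  K²≡n+1 = ≤-antisym (≮⇒≥ n+1≮K²) n<K²

square≤25*n : ∀ {n k d} → 0 < n → n < suc k * suc k → k * k ≤ n →
              d ≤ suc (suc k + suc k) → d * d ≤ 25 * n
square≤25*n {k = zero}          (s≤s _) (s≤s ())
square≤25*n {n} {suc m} {d} _ _ k²≤n d≤2k+3 = begin
  d * d                     ≤⟨ *-mono-≤ d≤5k d≤5k ⟩
  5 * suc m * (5 * suc m)   ≡⟨ 5k*5k≡25k² m ⟩
  25 * (suc m * suc m)      ≤⟨ *-monoʳ-≤ 25 k²≤n ⟩
  25 * n                    ∎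
  where
  open ≤-Reasoning
  2k+3+3m≡5k : ∀ m → suc (suc (suc m) + suc (suc m)) + 3 * m ≡ 5 * suc m
  2k+3+3m≡5k = solve-∀
  d≤5k : d ≤ 5 * suc m
  d≤5k = ≤-trans d≤2k+3
    (subst (suc (suc (suc m) + suc (suc m)) ≤_) (2k+3+3m≡5k m) (m≤m+n _ (3 * m)))
  5k*5k≡25k² : ∀ m → 5 * suc m * (5 * suc m) ≡ 25 * (suc m * suc m)
  5k*5k≡25k² = solve-∀

γ-replace-square-≤ : {T T' : List A} {g g' : ℕ} → Replacement T T' → 0 < length T →
                     IsGamma T g → IsGamma T' g' → (g' ∸ g) * (g' ∸ g) ≤ 25 * length T
γ-replace-square-≤ {g = g} {g'} edit@(replace X Y u≤1 v≤1) 0<n γT γT'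
  with k , k²≤n , n<K² ← isqrt (length (X ++ _ ++ Y)) =
  square≤25*n 0<n n<K² k²≤n
    (m≤n+o⇒m∸n≤o g' g
      (γ-replace-≤ X Y u≤1 v≤1 k (≤-trans (length-replacement≤ edit) n<K²) γT γT'))

theorem2 : (e : EditType) →
    Σ ℕ λ C → Σ ℕ λ N →
      ∀ {A : Set} (T T' : List A) → N ≤ length T → OneEdit e T T' →
      ∀ (g g' : ℕ) → IsGamma T g → IsGamma T' g' →
      (g' ∸ g) * (g' ∸ g) ≤ C * length T
theorem2 e = 25 , 1 , λ T T' 0<n edit g g' γT γT' →
  γ-replace-square-≤ (oneEdit⇒replacement e edit) 0<n γT γT'
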